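{- Let $\mathcal{F}$ be a finite $3$-uniform linear family with $S_{\mathcal{F}}=\emptyset$ and let $\mathcal{M}$ be a maximum matching of $\mathcal{F}$. With $\mathcal{E}_2$ as defined in the context, $\mathcal{E}_2=\emptyset$.
   Context: $3$-uniform: members have exactly $3$ elements; linear: distinct members share at most one element. $\mathcal{F}_x=\{A\in\mathcal{F}:x\in A\}$. $S_{\mathcal{F}}$ is the set of vertices covered by every maximum matching. $X_{\mathcal{M}}=\bigcup_{A\in\mathcal{M}}A$, $D_1(\mathcal{F})=\{A\in\mathcal{F}:|A\cap X_{\mathcal{M}}|=1\}$, and for $A\in\mathcal{M}$, $D_1(A)=\{B\in D_1(\mathcal{F}): B\cap A\neq\emptyset\}$, $d_1(A)=|D_1(A)|$. Let $\mathcal{M}_1=\{A\in\mathcal{M}: d_1(A)\geq 7\}=\{A_1,\dots,A_m\}$ and $\mathcal{M}_2=\mathcal{M}\setminus\mathcal{M}_1$; for each $A_i\in\mathcal{M}_1$ all members of $D_1(A_i)$ contain a common vertex of $A_i$, denoted $x_i$. Set $\mathcal{E}_1=\bigcup_{i=1}^m\mathcal{F}_{x_i}$ and $\mathcal{E}_2=\{A\in\mathcal{F}: A\cap B=\emptyset \text{ for all } B\in\mathcal{M}_2\}\setminus\mathcal{E}_1$. -}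

module Defs where

open import Data.Nat using (ℕ; _≤_; _≤?_)
open import Data.Bool using (Bool)
import Data.Bool as B
open import Data.Fin using (Fin)
open import Data.Fin.Subset using (Subset; _∈_; _∩_; ⋃; ∣_∣; ⊥)
open import Data.List using (List; length; filter)
open import Data.List.Membership.Propositional renaming (_∈_ to _∈ₗ_)
open import Data.List.Relation.Unary.All using (All)
open import Data.List.Relation.Unary.Unique.Propositional using (Unique)
open import Data.Product using (Σ; _×_; ∃)
open import Data.Vec.Properties using (≡-dec)
open import Relation.Binary.PropositionalEquality using (_≡_; _≢_)
open import Relation.Nullary using (¬_; Dec)
open import Relation.Nullary.Decidable using (_×-dec_; ¬?)
import Data.Nat as N

-- Vertices are Fin n; a member (edge) is a subset of Fin n.
-- A finite family is a duplicate-free list of subsets.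

_≟ₛ_ : ∀ {n} (A B : Subset n) → Dec (A ≡ B)
_≟ₛ_ = ≡-dec B._≟_

ThreeUniform : ∀ {n} → List (Subset n) → Set
ThreeUniform F = All (λ A → ∣ A ∣ ≡ 3) F

Linear : ∀ {n} → List (Subset n) → Set
Linear F = ∀ A B → A ∈ₗ F → B ∈ₗ F → A ≢ B → ∣ A ∩ B ∣ ≤ 1

IsMatching : ∀ {n} → List (Subset n) → List (Subset n) → Set
IsMatching F M =
  Unique M × (∀ A → A ∈ₗ M → A ∈ₗ F) ×
  (∀ A B → A ∈ₗ M → B ∈ₗ M → A ≢ B → A ∩ B ≡ ⊥)

IsMaxMatching : ∀ {n} → List (Subset n) → List (Subset n) → Set
IsMaxMatching F M =
  IsMatching F M × (∀ M' → IsMatching F M' → length M' ≤ length M)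

InS : ∀ {n} → List (Subset n) → Fin n → Set
InS F x = ∀ M → IsMaxMatching F M → x ∈ ⋃ M

X : ∀ {n} → List (Subset n) → Subset n
X M = ⋃ M

InD1A? : ∀ {n} (M : List (Subset n)) (A B : Subset n) →
         Dec ((∣ B ∩ X M ∣ ≡ 1) × ¬ (B ∩ A ≡ ⊥))
InD1A? M A B = (∣ B ∩ X M ∣ N.≟ 1) ×-dec ¬? ((B ∩ A) ≟ₛ ⊥)

-- d_1(A) = |D_1(A)|, where D_1(A) = {B ∈ D_1(F) : B ∩ A ≠ ∅}
-- and D_1(F) = {B ∈ F : |B ∩ X_M| = 1}.
d1 : ∀ {n} (F M : List (Subset n)) (A : Subset n) → ℕ
d1 F M A = length (filter (InD1A? M A) F)

InM1 : ∀ {n} (F M : List (Subset n)) (A : Subset n) → Set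
InM1 F M A = A ∈ₗ M × 7 ≤ d1 F M A

InM2 : ∀ {n} (F M : List (Subset n)) (A : Subset n) → Set
InM2 F M A = A ∈ₗ M × ¬ (7 ≤ d1 F M A)

-- B ∈ E_1 = ⋃_i F_{x_i}: B ∈ F and B contains a vertex x_i of some A_i ∈ M_1
-- that is common to all members of D_1(A_i).
InE1 : ∀ {n} (F M : List (Subset n)) (B : Subset n) → Set
InE1 F M B =
  B ∈ₗ F ×
  Σ (Subset _) λ A → InM1 F M A ×
  Σ (Fin _) λ x → x ∈ A ×
    (∀ C → C ∈ₗ F → (∣ C ∩ X M ∣ ≡ 1) → ¬ (C ∩ A ≡ ⊥) → x ∈ C) ×
    x ∈ B

InE2 : ∀ {n} (F M : List (Subset n)) (B : Subset n) → Set
InE2 F M B =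
  (B ∈ₗ F × (∀ A → InM2 F M A → B ∩ A ≡ ⊥)) × ¬ InE1 F M B

-- A member of D₁(A) meets X_M in a single vertex, which lies in A; hence it is
-- disjoint from every other member of M, and two disjoint members of D₁(A) could
-- replace A in M, contradicting maximality. If d₁(A) ≥ 7, some vertex x of A lies
-- in three members of D₁(A) (pigeonhole over the three vertices of A). By
-- linearity these pairwise meet only in x, so if some C ∈ D₁(A) missed x, one of
-- them would avoid the two vertices of C outside X_M and so be disjoint from C.
--
-- Now let B ∈ E₂, and let A₁, …, A_k be the members of M meeting B. Each Aᵢ lies
-- in M₁ with x_{Aᵢ} ∉ B, and k ≤ |B ∩ X_M|. Greedily pick Cᵢ ∈ D₁(Aᵢ) avoiding the
-- vertices of B and of C₁, …, C_{i-1} outside X_M: at most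
-- |B ∖ X_M| + 2(k - 1) ≤ 4 vertices are forbidden, each in at most one member of
-- D₁(Aᵢ), and d₁(Aᵢ) ≥ 7. Then (M ∖ {A₁, …, A_k}) ∪ {B, C₁, …, C_k} is a larger
-- matching.

module Submission where

open import Defs
open import Data.Nat using (ℕ; suc; _+_; _*_; _≤_; _<_; z≤n; s≤s)
open import Data.Nat.Properties
open import Data.Nat.Tactic.RingSolver using (solve-∀)
open import Data.Fin as Fin using (Fin; zero; suc)
open import Data.Fin.Subset
  using (Subset; inside; outside; _∈_; _∉_; _∩_; ⋃; ∣_∣; ⊥; Nonempty)
open import Data.Fin.Subset.Properties
open import Data.List using (List; []; _∷_; length; filter; _++_; map; concatMap)
open import Data.List.Properties using (length-map; length-++; filter-none; filter-notAll)
open import Data.List.Membership.Propositional using (find; lose) renaming (_∈_ to _∈ₗ_)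
open import Data.List.Membership.Propositional.Properties using (∈-filter⁺; ∈-filter⁻; ∈-map⁺; ∈-map⁻)
open import Data.List.Relation.Unary.Any as Any using (Any; here; there)
open import Data.List.Relation.Unary.All as All using (All; []; _∷_)
import Data.List.Relation.Unary.All.Properties as All
open import Data.List.Relation.Unary.AllPairs as AllPairs using (AllPairs; []; _∷_)
import Data.List.Relation.Unary.AllPairs.Properties as AllPairs
open import Data.List.Relation.Unary.Unique.Propositional using (Unique)
import Data.List.Relation.Unary.Unique.Propositional.Properties as Unique
open import Data.List.Relation.Binary.Sublist.Propositional.Properties
  using (filter⁺; filter-⊆; length-mono-≤)
open import Data.Product using (_×_; ∃; _,_; proj₁; proj₂)
open import Data.Vec using ([]; _∷_; here; there)
open import Data.Sum using (inj₁; inj₂)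
open import Data.Empty as Empty using (⊥-elim)
open import Function using (_∘_; id)
open import Relation.Binary using (Rel; Symmetric)
open import Relation.Binary.PropositionalEquality
open import Relation.Nullary using (¬_; yes; no; contradiction)
open import Relation.Nullary.Decidable using (¬?; decidable-stable)
open import Relation.Unary using (Pred; Decidable)
open import Relation.Unary.Properties using (∁?)

length-filter-∁ : ∀ {A : Set} {p} {P : Pred A p} (P? : Decidable P) (xs : List A) →
  length (filter P? xs) + length (filter (∁? P?) xs) ≡ length xs
length-filter-∁ P? [] = refl
length-filter-∁ P? (x ∷ xs) with P? x
... | yes _ = cong suc (length-filter-∁ P? xs)
... | no _ = trans (+-suc _ _) (cong suc (length-filter-∁ P? xs))

length-concatMap-≤ : ∀ {A B : Set} (f : A → List B) {k} {xs : List A} →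
  All (λ x → length (f x) ≤ k) xs → length (concatMap f xs) ≤ k * length xs
length-concatMap-≤ f [] = z≤n
length-concatMap-≤ f {k} {x ∷ xs} (fx≤k ∷ fxs≤k) = begin
  length (f x ++ concatMap f xs)      ≡⟨ length-++ (f x) ⟩
  length (f x) + length (concatMap f xs) ≤⟨ +-mono-≤ fx≤k (length-concatMap-≤ f fxs≤k) ⟩
  k + k * length xs                    ≡⟨ *-suc k (length xs) ⟨
  k * suc (length xs)                  ∎
  where open ≤-Reasoning

Unique⇒AllPairs : ∀ {A : Set} {r} {R : Rel A r} {xs : List A} → Unique xs →
  (∀ {x y} → x ∈ₗ xs → y ∈ₗ xs → x ≢ y → R x y) → AllPairs R xs
Unique⇒AllPairs [] _ = []
Unique⇒AllPairs (x∉xs ∷ u) r =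
  All.tabulate (λ y∈xs → r (here refl) (there y∈xs) (All.lookup x∉xs y∈xs))
  ∷ Unique⇒AllPairs u (λ x∈ y∈ → r (there x∈) (there y∈))

AllPairs-lookup : ∀ {A : Set} {r} {R : Rel A r} {xs : List A} {x y} → Symmetric R →
  AllPairs R xs → x ∈ₗ xs → y ∈ₗ xs → x ≢ y → R x y
AllPairs-lookup sym _ (here refl) (here refl) x≢y = ⊥-elim (x≢y refl)
AllPairs-lookup sym (Rxs ∷ _) (here refl) (there y∈) _ = All.lookup Rxs y∈
AllPairs-lookup sym (Rys ∷ _) (there x∈) (here refl) _ = sym (All.lookup Rys x∈)
AllPairs-lookup sym (_ ∷ Rs) (there x∈) (there y∈) x≢y = AllPairs-lookup sym Rs x∈ y∈ x≢y

elements : ∀ {n} → Subset n → List (Fin n)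
elements [] = []
elements (inside ∷ p) = zero ∷ map suc (elements p)
elements (outside ∷ p) = map suc (elements p)

length-elements : ∀ {n} (p : Subset n) → length (elements p) ≡ ∣ p ∣
length-elements [] = refl
length-elements (inside ∷ p) = cong suc (trans (length-map suc (elements p)) (length-elements p))
length-elements (outside ∷ p) = trans (length-map suc (elements p)) (length-elements p)

∈-elements⁺ : ∀ {n} {x : Fin n} {p : Subset n} → x ∈ p → x ∈ₗ elements p
∈-elements⁺ {p = inside ∷ p} here = here refl
∈-elements⁺ {p = inside ∷ p} (there x∈p) = there (∈-map⁺ suc (∈-elements⁺ x∈p))
∈-elements⁺ {p = outside ∷ p} (there x∈p) = ∈-map⁺ suc (∈-elements⁺ x∈p)

∈-elements⁻ : ∀ {n} {x : Fin n} (p : Subset n) → x ∈ₗ elements p → x ∈ p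
∈-elements⁻ (inside ∷ p) (here refl) = here
∈-elements⁻ (inside ∷ p) (there x∈) with ∈-map⁻ suc x∈
... | _ , y∈ , refl = there (∈-elements⁻ p y∈)
∈-elements⁻ (outside ∷ p) x∈ with ∈-map⁻ suc x∈
... | _ , y∈ , refl = there (∈-elements⁻ p y∈)

module _ {n : ℕ} where

  Disjoint : Rel (Subset n) _
  Disjoint p q = p ∩ q ≡ ⊥

  disjoint-sym : Symmetric Disjoint
  disjoint-sym {p} {q} p∩q≡⊥ = trans (∩-comm q p) p∩q≡⊥

  disjoint⇒∉ : ∀ {p q : Subset n} {x} → Disjoint p q → x ∈ p → x ∉ q
  disjoint⇒∉ p∩q≡⊥ x∈p x∈q = ∉⊥ (subst (_ ∈_) p∩q≡⊥ (x∈p∩q⁺ (x∈p , x∈q)))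

  ∉⇒disjoint : ∀ {p q : Subset n} → (∀ {x} → x ∈ p → x ∉ q) → Disjoint p q
  ∉⇒disjoint {p} {q} ∉q = Empty-unique λ (x , x∈p∩q) →
    let x∈p , x∈q = x∈p∩q⁻ p q x∈p∩q in ∉q x∈p x∈q

  ≢⊥⇒Nonempty : ∀ {p : Subset n} → p ≢ ⊥ → Nonempty p
  ≢⊥⇒Nonempty {p} p≢⊥ with nonempty? p
  ... | yes ne = ne
  ... | no ¬ne = contradiction (Empty-unique ¬ne) p≢⊥

  0<∣p∣⇒Nonempty : ∀ {p : Subset n} → 0 < ∣ p ∣ → Nonempty p
  0<∣p∣⇒Nonempty 0<∣p∣ = ≢⊥⇒Nonempty λ { refl → <-irrefl (sym (∣⊥∣≡0 n)) 0<∣p∣ }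

  ∣p∣≤1⇒x≡y : ∀ {p : Subset n} {x y} → ∣ p ∣ ≤ 1 → x ∈ p → y ∈ p → x ≡ y
  ∣p∣≤1⇒x≡y {p} {x} {y} ∣p∣≤1 x∈p y∈p with x Fin.≟ y
  ... | yes x≡y = x≡y
  ... | no x≢y = contradiction (≤-trans 2≤∣p∣ ∣p∣≤1) λ { (s≤s ()) }
    where
    2≤∣p∣ : 2 ≤ ∣ p ∣
    2≤∣p∣ = ≤-trans (s≤s (s≤s z≤n))
      (≤-trans (s≤s (x∈p⇒∣p-x∣<∣p∣ (x∈p∧x≢y⇒x∈p-y y∈p (x≢y ∘ sym)))) (x∈p⇒∣p-x∣<∣p∣ x∈p))

  ∈-⋃⁺ : ∀ {p : Subset n} {ps x} → p ∈ₗ ps → x ∈ p → x ∈ ⋃ ps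
  ∈-⋃⁺ (here refl) x∈p = x∈p∪q⁺ (inj₁ x∈p)
  ∈-⋃⁺ (there p∈ps) x∈p = x∈p∪q⁺ (inj₂ (∈-⋃⁺ p∈ps x∈p))

  nonempty-disjoint⇒Unique : ∀ {ps : List (Subset n)} →
    All Nonempty ps → AllPairs Disjoint ps → Unique ps
  nonempty-disjoint⇒Unique [] [] = []
  nonempty-disjoint⇒Unique ((x , x∈p) ∷ nes) (ds ∷ dss) =
    All.map (λ { p∩q≡⊥ refl → disjoint⇒∉ p∩q≡⊥ x∈p x∈p }) ds
    ∷ nonempty-disjoint⇒Unique nes dss

  degree : Fin n → List (Subset n) → ℕ
  degree x ps = length (filter (x ∈?_) ps)

  Hits : List (Fin n) → Subset n → Set
  Hits xs p = Any (_∈ p) xs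

  degree≤1 : ∀ {x ps} → AllPairs (λ p q → x ∈ p → x ∉ q) ps → degree x ps ≤ 1
  degree≤1 [] = z≤n
  degree≤1 {x} {p ∷ ps} (x∉ps ∷ rest) with x ∈? p
  ... | yes x∈p = s≤s (≤-reflexive (cong length (filter-none (x ∈?_) (All.map (λ f → f x∈p) x∉ps))))
  ... | no _ = degree≤1 rest

  disjoint⇒degree≤1 : ∀ {x ps} → AllPairs Disjoint ps → degree x ps ≤ 1
  disjoint⇒degree≤1 = degree≤1 ∘ AllPairs.map disjoint⇒∉

  degree-filter-≤ : ∀ {p} {P : Pred (Subset n) p} (P? : Decidable P) y ps →
    degree y (filter P? ps) ≤ degree y ps
  degree-filter-≤ P? y ps = length-mono-≤ (filter⁺ (y ∈?_) (y ∈?_) (λ { refl → id }) (filter-⊆ P? ps))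

  double-counting : ∀ k (xs : List (Fin n)) (ps : List (Subset n)) →
    All (Hits xs) ps → All (λ x → degree x ps ≤ k) xs → length ps ≤ k * length xs
  double-counting k [] [] _ _ = z≤n
  double-counting k [] (p ∷ ps) (() ∷ _) _
  double-counting k (x ∷ xs) ps hits (degx≤k ∷ degs≤k) = begin
    length ps                   ≡⟨ length-filter-∁ (x ∈?_) ps ⟨
    degree x ps + length ps'    ≤⟨ +-mono-≤ degx≤k (double-counting k xs ps' hits' degs'≤k) ⟩
    k + k * length xs           ≡⟨ *-suc k (length xs) ⟨
    k * suc (length xs)         ∎
    where
    open ≤-Reasoning
    ps' : List (Subset n)
    ps' = filter (∁? (x ∈?_)) ps
    drop-x : ∀ {p} → Hits (x ∷ xs) p → x ∉ p → Hits xs p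
    drop-x (here x∈p) x∉p = contradiction x∈p x∉p
    drop-x (there hit) _ = hit
    hits' : All (Hits xs) ps'
    hits' = All.tabulate λ p∈ps' →
      let p∈ps , x∉p = ∈-filter⁻ (∁? (x ∈?_)) p∈ps' in drop-x (All.lookup hits p∈ps) x∉p
    degs'≤k : All (λ y → degree y ps' ≤ k) xs
    degs'≤k = All.map (λ {y} → ≤-trans (degree-filter-≤ (∁? (x ∈?_)) y ps)) degs≤k

  pigeonhole : ∀ k (xs : List (Fin n)) (ps : List (Subset n)) →
    All (Hits xs) ps → k * length xs < length ps → ∃ λ x → x ∈ₗ xs × k < degree x ps
  pigeonhole k xs ps hits many with All.all? (λ x → degree x ps ≤? k) xs
  ... | yes degs≤k = contradiction (double-counting k xs ps hits degs≤k) (<⇒≱ many)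
  ... | no ¬degs≤k = find (Any.map ≰⇒> (All.¬All⇒Any¬ (λ x → degree x ps ≤? k) xs ¬degs≤k))

  avoiding-member : ∀ k (xs : List (Fin n)) (ps : List (Subset n)) →
    All (λ x → degree x ps ≤ k) xs → k * length xs < length ps → ∃ λ p → p ∈ₗ ps × All (_∉ p) xs
  avoiding-member k xs ps degs≤k many with Any.any? (λ p → All.all? (λ x → ¬? (x ∈? p)) xs) ps
  ... | yes avoiding = find avoiding
  ... | no ¬avoiding = contradiction (double-counting k xs ps hits degs≤k) (<⇒≱ many)
    where
    hits : All (Hits xs) ps
    hits = All.map (λ {p} ¬avoids → Any.map (decidable-stable (_ ∈? p))
                                            (All.¬All⇒Any¬ (λ x → ¬? (x ∈? p)) xs ¬avoids))
                   (All.¬Any⇒All¬ ps ¬avoiding)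

module MaximumMatching {n : ℕ} {F : List (Subset n)} (F-unique : Unique F)
  (F-uniform : ThreeUniform F) (F-linear : Linear F)
  {M : List (Subset n)} (M-maximum : IsMaxMatching F M) where

  M-unique : Unique M
  M-unique = proj₁ (proj₁ M-maximum)

  M⊆F : ∀ {A} → A ∈ₗ M → A ∈ₗ F
  M⊆F = proj₁ (proj₂ (proj₁ M-maximum)) _

  M-disjoint : AllPairs Disjoint M
  M-disjoint = Unique⇒AllPairs M-unique (proj₂ (proj₂ (proj₁ M-maximum)) _ _)

  ∣F∣≡3 : ∀ {C} → C ∈ₗ F → ∣ C ∣ ≡ 3
  ∣F∣≡3 = All.lookup F-uniform

  nonempty : ∀ {C} → C ∈ₗ F → Nonempty C
  nonempty C∈F = 0<∣p∣⇒Nonempty (subst (0 <_) (sym (∣F∣≡3 C∈F)) (s≤s z≤n))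

  disjoint⇒≤M : ∀ {N} → All (_∈ₗ F) N → AllPairs Disjoint N → length N ≤ length M
  disjoint⇒≤M N⊆F N-disjoint = proj₂ M-maximum _
    ( nonempty-disjoint⇒Unique (All.map nonempty N⊆F) N-disjoint
    , (λ _ → All.lookup N⊆F)
    , (λ _ _ → AllPairs-lookup disjoint-sym N-disjoint))

  replacement-bound : ∀ {p} {P : Pred (Subset n) p} (P? : Decidable P) {Cs} →
    All (_∈ₗ F) Cs → AllPairs Disjoint Cs → All (λ C → All (Disjoint C) (filter (∁? P?) M)) Cs →
    length Cs ≤ length (filter P? M)
  replacement-bound P? {Cs} Cs⊆F Cs-disjoint Cs-avoid-kept =
    +-cancelʳ-≤ (length kept) _ _ (begin
      length Cs + length kept            ≡⟨ length-++ Cs ⟨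
      length (Cs ++ kept)                ≤⟨ disjoint⇒≤M N⊆F N-disjoint ⟩
      length M                           ≡⟨ length-filter-∁ P? M ⟨
      length (filter P? M) + length kept ∎)
    where
    open ≤-Reasoning
    kept : List (Subset n)
    kept = filter (∁? P?) M
    N⊆F : All (_∈ₗ F) (Cs ++ kept)
    N⊆F = All.++⁺ Cs⊆F (All.tabulate (M⊆F ∘ proj₁ ∘ ∈-filter⁻ (∁? P?)))
    N-disjoint : AllPairs Disjoint (Cs ++ kept)
    N-disjoint = AllPairs.++⁺ Cs-disjoint (AllPairs.filter⁺ (∁? P?) M-disjoint) Cs-avoid-kept

  D₁ : Subset n → Subset n → Set
  D₁ A C = C ∈ₗ F × ∣ C ∩ X M ∣ ≡ 1 × ¬ (C ∩ A ≡ ⊥)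

  D₁-list : Subset n → List (Subset n)
  D₁-list A = filter (InD1A? M A) F

  ∈D₁-list⁻ : ∀ {A C} → C ∈ₗ D₁-list A → D₁ A C
  ∈D₁-list⁻ {A} = ∈-filter⁻ (InD1A? M A)

  D₁-disjoint : ∀ {A A' C} → A ∈ₗ M → D₁ A C → A' ∈ₗ M → A' ≢ A → Disjoint C A'
  D₁-disjoint {A} {A'} {C} A∈M (_ , ∣C∩X∣≡1 , C∩A≢⊥) A'∈M A'≢A = ∉⇒disjoint λ v∈C v∈A' →
    let y , y∈C∩A = ≢⊥⇒Nonempty C∩A≢⊥
        y∈C , y∈A = x∈p∩q⁻ C A y∈C∩A
        v≡y = ∣p∣≤1⇒x≡y (≤-reflexive ∣C∩X∣≡1)
                (x∈p∩q⁺ (v∈C , ∈-⋃⁺ A'∈M v∈A')) (x∈p∩q⁺ (y∈C , ∈-⋃⁺ A∈M y∈A))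
    in disjoint⇒∉ (AllPairs-lookup disjoint-sym M-disjoint A'∈M A∈M A'≢A) v∈A' (subst (_∈ A) (sym v≡y) y∈A)

  D₁-intersecting : ∀ {A C D} → A ∈ₗ M → D₁ A C → D₁ A D → ¬ Disjoint C D
  D₁-intersecting {A} {C} {D} A∈M C∈D₁ D∈D₁ C∩D≡⊥ =
    contradiction (≤-trans two≤degree (disjoint⇒degree≤1 M-disjoint)) λ { (s≤s ()) }
    where
    C∩A-witness : Nonempty (C ∩ A)
    C∩A-witness = ≢⊥⇒Nonempty (proj₂ (proj₂ C∈D₁))
    a : Fin n
    a = proj₁ C∩A-witness
    a∈A : a ∈ A
    a∈A = proj₂ (x∈p∩q⁻ C A (proj₂ C∩A-witness))
    avoids-kept : ∀ {E} → D₁ A E → All (Disjoint E) (filter (∁? (a ∈?_)) M)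
    avoids-kept E∈D₁ = All.tabulate λ A'∈kept →
      let A'∈M , a∉A' = ∈-filter⁻ (∁? (a ∈?_)) A'∈kept
      in D₁-disjoint A∈M E∈D₁ A'∈M λ { refl → a∉A' a∈A }
    two≤degree : 2 ≤ degree a M
    two≤degree = replacement-bound (a ∈?_)
      (proj₁ C∈D₁ ∷ proj₁ D∈D₁ ∷ [])
      ((C∩D≡⊥ ∷ []) ∷ [] ∷ [])
      (avoids-kept C∈D₁ ∷ avoids-kept D∈D₁ ∷ [])

  D₁-meets-X : ∀ {A C} → D₁ A C → Nonempty (C ∩ X M)
  D₁-meets-X (_ , ∣C∩X∣≡1 , _) = 0<∣p∣⇒Nonempty (subst (0 <_) (sym ∣C∩X∣≡1) (s≤s z≤n))

  exterior : Subset n → List (Fin n)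
  exterior C = filter (∁? (_∈? X M)) (elements C)

  exterior-∉X : ∀ C → All (_∉ X M) (exterior C)
  exterior-∉X C = All.all-filter (∁? (_∈? X M)) (elements C)

  length-exterior≤2 : ∀ {C} → C ∈ₗ F → Nonempty (C ∩ X M) → length (exterior C) ≤ 2
  length-exterior≤2 {C} C∈F (x , x∈C∩X) =
    ≤-pred (subst (length (exterior C) <_) (trans (length-elements C) (∣F∣≡3 C∈F))
      (filter-notAll (∁? (_∈? X M)) (elements C) (lose (∈-elements⁺ x∈C) λ x∉X → x∉X x∈X)))
    where
    x∈C : x ∈ C
    x∈C = proj₁ (x∈p∩q⁻ C (X M) x∈C∩X)
    x∈X : x ∈ X M
    x∈X = proj₂ (x∈p∩q⁻ C (X M) x∈C∩X)

  -- D meets X_M only in x, so D ∩ C can only contain vertices outside X_M.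
  avoiding-exterior⇒disjoint : ∀ {C D x} → ∣ D ∩ X M ∣ ≡ 1 → x ∈ D → x ∈ X M → x ∉ C →
    All (_∉ D) (exterior C) → Disjoint D C
  avoiding-exterior⇒disjoint {C} {D} {x} ∣D∩X∣≡1 x∈D x∈X x∉C avoids = ∉⇒disjoint ∉C
    where
    ∉C : ∀ {w} → w ∈ D → w ∉ C
    ∉C {w} w∈D w∈C with w ∈? X M
    ... | yes w∈X = x∉C (subst (_∈ C)
      (∣p∣≤1⇒x≡y (≤-reflexive ∣D∩X∣≡1) (x∈p∩q⁺ (w∈D , w∈X)) (x∈p∩q⁺ (x∈D , x∈X))) w∈C)
    ... | no w∉X = All.lookup avoids (∈-filter⁺ (∁? (_∈? X M)) (∈-elements⁺ w∈C) w∉X) w∈D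

  star-degree≤1 : ∀ {x t K} → Unique K → All (λ D → D ∈ₗ F × x ∈ D) K → t ≢ x → degree t K ≤ 1
  star-degree≤1 {x} {t} K-unique K-star t≢x =
    degree≤1 (Unique⇒AllPairs K-unique λ D∈K D'∈K D≢D' t∈D t∈D' →
      let D∈F , x∈D = All.lookup K-star D∈K
          D'∈F , x∈D' = All.lookup K-star D'∈K
      in t≢x (∣p∣≤1⇒x≡y (F-linear _ _ D∈F D'∈F D≢D') (x∈p∩q⁺ (t∈D , t∈D')) (x∈p∩q⁺ (x∈D , x∈D'))))

  D₁-star-degree≤1 : ∀ {A x t} → All (x ∈_) (D₁-list A) → t ≢ x → degree t (D₁-list A) ≤ 1
  D₁-star-degree≤1 {A} all∋x = star-degree≤1 (Unique.filter⁺ (InD1A? M A) F-unique)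
    (All.tabulate λ D∈list → proj₁ (∈D₁-list⁻ D∈list) , All.lookup all∋x D∈list)

  popular⇒common : ∀ {A x} → A ∈ₗ M → x ∈ A → 2 < degree x (D₁-list A) → ∀ {C} → D₁ A C → x ∈ C
  popular⇒common {A} {x} A∈M x∈A popular {C} C∈D₁ with x ∈? C
  ... | yes x∈C = x∈C
  ... | no x∉C =
    let D , D∈star , D-avoids = avoiding-member 1 (exterior C) star degrees few
        D∈list , x∈D = ∈-filter⁻ (x ∈?_) D∈star
        D∈D₁ = ∈D₁-list⁻ D∈list
    in ⊥-elim (D₁-intersecting A∈M D∈D₁ C∈D₁
         (avoiding-exterior⇒disjoint (proj₁ (proj₂ D∈D₁)) x∈D (∈-⋃⁺ A∈M x∈A) x∉C D-avoids))
    where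
    star : List (Subset n)
    star = filter (x ∈?_) (D₁-list A)
    star-members : All (λ D → D ∈ₗ F × x ∈ D) star
    star-members = All.tabulate λ D∈star →
      let D∈list , x∈D = ∈-filter⁻ (x ∈?_) D∈star in proj₁ (∈D₁-list⁻ D∈list) , x∈D
    degrees : All (λ t → degree t star ≤ 1) (exterior C)
    degrees = All.map (λ t∉X → star-degree≤1 (Unique.filter⁺ (x ∈?_) (Unique.filter⁺ (InD1A? M A) F-unique))
                                 star-members λ { refl → t∉X (∈-⋃⁺ A∈M x∈A) })
                      (exterior-∉X C)
    few : 1 * length (exterior C) < length star
    few = ≤-trans (s≤s (≤-trans (≤-reflexive (*-identityˡ _)) (length-exterior≤2 (proj₁ C∈D₁) (D₁-meets-X C∈D₁)))) popular

  common-vertex : ∀ {A} → A ∈ₗ M → 7 ≤ d1 F M A → ∃ λ x → x ∈ A × ∀ {C} → D₁ A C → x ∈ C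
  common-vertex {A} A∈M many =
    let x , x∈elements , popular = pigeonhole 2 (elements A) (D₁-list A) hits few
        x∈A = ∈-elements⁻ A x∈elements
    in x , x∈A , popular⇒common A∈M x∈A popular
    where
    hits : All (Hits (elements A)) (D₁-list A)
    hits = All.tabulate λ {C} C∈list →
      let y , y∈C∩A = ≢⊥⇒Nonempty (proj₂ (proj₂ (∈D₁-list⁻ C∈list)))
          y∈C , y∈A = x∈p∩q⁻ C A y∈C∩A
      in lose (∈-elements⁺ y∈A) y∈C
    few : 2 * length (elements A) < length (D₁-list A)
    few = subst (λ k → 2 * k < length (D₁-list A)) (sym (trans (length-elements A) (∣F∣≡3 (M⊆F A∈M)))) many

  module _ {B : Subset n} (B∈F : B ∈ₗ F) (B-misses-M₂ : ∀ A → InM2 F M A → B ∩ A ≡ ⊥)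
           (B∉E₁ : ¬ InE1 F M B) where

    Meets : Subset n → Set
    Meets A = ¬ Disjoint B A

    meets? : Decidable Meets
    meets? A = ¬? ((B ∩ A) ≟ₛ ⊥)

    record Centre (A : Subset n) : Set where
      field
        many : 7 ≤ d1 F M A
        x : Fin n
        x∈A : x ∈ A
        common : ∀ {C} → D₁ A C → x ∈ C
        x∉B : x ∉ B

    centre : ∀ {A} → A ∈ₗ M → Meets A → Centre A
    centre {A} A∈M meets with 7 ≤? d1 F M A
    ... | no few = contradiction (B-misses-M₂ A (A∈M , few)) meets
    ... | yes many =
      let x , x∈A , common = common-vertex A∈M many
      in record { many = many ; x = x ; x∈A = x∈A ; common = common
                ; x∉B = λ x∈B → B∉E₁ (B∈F , A , (A∈M , many) , x , x∈A ,
                                      (λ C C∈F ∣C∩X∣≡1 C∩A≢⊥ → common (C∈F , ∣C∩X∣≡1 , C∩A≢⊥)) , x∈B) }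

    Replacement : Subset n → Subset n → Set
    Replacement A C = D₁ A C × Disjoint C B

    fresh-replacement : ∀ {A} → A ∈ₗ M → Meets A → (Cs : List (Subset n)) →
      All (λ C' → ∃ λ A' → A' ∈ₗ M × A' ≢ A × D₁ A' C') Cs →
      length (exterior B) + 2 * length Cs < 7 →
      ∃ λ C → Replacement A C × All (Disjoint C) Cs
    fresh-replacement {A} A∈M meets Cs Cs-replace room =
      C , (C∈D₁ , disjoint-from x∉B (All.head avoids)) ,
      All.zipWith (λ (x∉C' , avoids-C') → disjoint-from x∉C' avoids-C') (x∉Cs , All.tail avoids)
      where
      open Centre (centre A∈M meets)
      x∈X : x ∈ X M
      x∈X = ∈-⋃⁺ A∈M x∈A
      forbidden : List (Fin n)
      forbidden = concatMap exterior (B ∷ Cs)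
      degrees : All (λ t → degree t (D₁-list A) ≤ 1) forbidden
      degrees = All.map (λ t∉X → D₁-star-degree≤1 (All.tabulate (common ∘ ∈D₁-list⁻)) λ { refl → t∉X x∈X })
                        (All.concat⁺ (All.map⁺ (All.tabulate {xs = B ∷ Cs} λ {E} _ → exterior-∉X E)))
      few : 1 * length forbidden < length (D₁-list A)
      few = begin-strict
        1 * length forbidden                                  ≡⟨ *-identityˡ _ ⟩
        length forbidden                                      ≡⟨ length-++ (exterior B) ⟩
        length (exterior B) + length (concatMap exterior Cs)  ≤⟨ +-monoʳ-≤ (length (exterior B))
          (length-concatMap-≤ exterior (All.map (λ (_ , _ , _ , C'∈D₁) →
            length-exterior≤2 (proj₁ C'∈D₁) (D₁-meets-X C'∈D₁)) Cs-replace)) ⟩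
        length (exterior B) + 2 * length Cs                   <⟨ room ⟩
        7                                                     ≤⟨ many ⟩
        length (D₁-list A)                                    ∎
        where open ≤-Reasoning
      choice : ∃ λ C → C ∈ₗ D₁-list A × All (_∉ C) forbidden
      choice = avoiding-member 1 forbidden (D₁-list A) degrees few
      C : Subset n
      C = proj₁ choice
      C∈D₁ : D₁ A C
      C∈D₁ = ∈D₁-list⁻ (proj₁ (proj₂ choice))
      avoids : All (λ E → All (_∉ C) (exterior E)) (B ∷ Cs)
      avoids = All.map⁻ (All.concat⁻ (proj₂ (proj₂ choice)))
      disjoint-from : ∀ {E} → x ∉ E → All (_∉ C) (exterior E) → Disjoint C E
      disjoint-from = avoiding-exterior⇒disjoint (proj₁ (proj₂ C∈D₁)) (common C∈D₁) x∈X
      x∉Cs : All (x ∉_) Cs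
      x∉Cs = All.map (λ (A' , A'∈M , A'≢A , C'∈D₁) →
        disjoint⇒∉ (disjoint-sym (D₁-disjoint A'∈M C'∈D₁ A∈M (A'≢A ∘ sym))) x∈A) Cs-replace

    Replaced : List (Subset n) → Subset n → Set
    Replaced todo C = ∃ λ A → A ∈ₗ todo × Replacement A C

    replacements : (todo : List (Subset n)) → Unique todo → All (λ A → A ∈ₗ M × Meets A) todo →
      length (exterior B) + 2 * length todo ≤ 6 →
      ∃ λ Cs → length Cs ≡ length todo × AllPairs Disjoint Cs × All (Replaced todo) Cs
    replacements [] _ _ _ = [] , refl , [] , []
    replacements (A ∷ rest) (A≢rest ∷ rest-unique) ((A∈M , meets) ∷ rest-meet) room =
      let Cs , |Cs|≡|rest| , Cs-disjoint , Cs-replace = replacements rest rest-unique rest-meet room'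
          C , C-replaces , C-new = fresh-replacement A∈M meets Cs (All.map earlier Cs-replace)
            (s≤s (subst (λ k → length (exterior B) + 2 * k ≤ 6) (sym |Cs|≡|rest|) room'))
      in C ∷ Cs , cong suc |Cs|≡|rest| , C-new ∷ Cs-disjoint ,
         (A , here refl , C-replaces) ∷ All.map (λ (A' , A'∈rest , r) → A' , there A'∈rest , r) Cs-replace
      where
      room' : length (exterior B) + 2 * length rest ≤ 6
      room' = ≤-trans (+-monoʳ-≤ (length (exterior B)) (*-monoʳ-≤ 2 (n≤1+n (length rest)))) room
      earlier : ∀ {C'} → Replaced rest C' → ∃ λ A' → A' ∈ₗ M × A' ≢ A × D₁ A' C'
      earlier (A' , A'∈rest , C'∈D₁ , _) =
        A' , proj₁ (All.lookup rest-meet A'∈rest) , All.lookup A≢rest A'∈rest ∘ sym , C'∈D₁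

    R : List (Subset n)
    R = filter meets? M

    initial-room : length (exterior B) + 2 * length R ≤ 6
    initial-room = begin
      e + 2 * length R ≤⟨ +-monoʳ-≤ e (*-monoʳ-≤ 2 |R|≤i) ⟩
      e + 2 * i        ≡⟨ rearrange e i ⟩
      (i + e) + i      ≡⟨ cong (_+ i) i+e≡3 ⟩
      3 + i            ≤⟨ +-monoʳ-≤ 3 (subst (i ≤_) i+e≡3 (m≤m+n i e)) ⟩
      6                ∎
      where
      open ≤-Reasoning
      inX : List (Fin n)
      inX = filter (_∈? X M) (elements B)
      i e : ℕ
      i = length inX
      e = length (exterior B)
      rearrange : ∀ a b → a + 2 * b ≡ (b + a) + b
      rearrange = solve-∀
      i+e≡3 : i + e ≡ 3
      i+e≡3 = trans (length-filter-∁ (_∈? X M) (elements B)) (trans (length-elements B) (∣F∣≡3 B∈F))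
      hits : All (Hits inX) R
      hits = All.tabulate λ {A} A∈R →
        let A∈M , meets = ∈-filter⁻ meets? {xs = M} A∈R
            w , w∈B∩A = ≢⊥⇒Nonempty meets
            w∈B , w∈A = x∈p∩q⁻ B A w∈B∩A
        in lose (∈-filter⁺ (_∈? X M) (∈-elements⁺ w∈B) (∈-⋃⁺ A∈M w∈A)) w∈A
      |R|≤i : length R ≤ i
      |R|≤i = subst (length R ≤_) (*-identityˡ i) (double-counting 1 inX R hits
        (All.tabulate λ _ → disjoint⇒degree≤1 (AllPairs.filter⁺ meets? M-disjoint)))

    larger-matching : Empty.⊥
    larger-matching =
      let Cs , |Cs|≡|R| , Cs-disjoint , Cs-replace =
            replacements R (Unique.filter⁺ meets? M-unique) (All.tabulate (∈-filter⁻ meets?)) initial-room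
      in <-irrefl |Cs|≡|R| (replacement-bound meets?
           (B∈F ∷ All.map (λ (_ , _ , C∈D₁ , _) → proj₁ C∈D₁) Cs-replace)
           (All.map (λ (_ , _ , _ , C∩B≡⊥) → disjoint-sym C∩B≡⊥) Cs-replace ∷ Cs-disjoint)
           (B-avoids-kept ∷ All.map C-avoids-kept Cs-replace))
      where
      kept : List (Subset n)
      kept = filter (∁? meets?) M
      B-avoids-kept : All (Disjoint B) kept
      B-avoids-kept = All.tabulate λ {A'} A'∈kept →
        decidable-stable ((B ∩ A') ≟ₛ ⊥) (proj₂ (∈-filter⁻ (∁? meets?) {xs = M} A'∈kept))
      C-avoids-kept : ∀ {C} → Replaced R C → All (Disjoint C) kept
      C-avoids-kept (A , A∈R , C∈D₁ , _) = All.tabulate λ A'∈kept →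
        let A∈M , meets = ∈-filter⁻ meets? {xs = M} A∈R
            A'∈M , misses = ∈-filter⁻ (∁? meets?) {xs = M} A'∈kept
        in D₁-disjoint A∈M C∈D₁ A'∈M λ { refl → misses meets }

proposition7 : (n : ℕ) (F : List (Subset n)) → Unique F → ThreeUniform F → Linear F
    → (∀ (x : Fin n) → ¬ InS F x)
    → (M : List (Subset n)) → IsMaxMatching F M
    → ∀ (B : Subset n) → ¬ InE2 F M B
proposition7 n F F-unique F-uniform F-linear _ M M-maximum B ((B∈F , B-misses-M₂) , B∉E₁) =
  MaximumMatching.larger-matching F-unique F-uniform F-linear M-maximum B∈F B-misses-M₂ B∉E₁
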